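{- For rationals $t\neq t'$ in $\mathbb{Q}\cap[0,1]$, the $q$-Markov numbers $m^t_q$ and $m^{t'}_q$ are different Laurent polynomials in $q$.
   Context: Let $q$ be a formal variable and $[3]_q=q^2+q+1$. Two rationals $\frac{r}{s}<\frac{r'}{s'}$ in $[0,1]$, written in lowest terms with $s,s'>0$, are Farey neighbours if $r's-rs'=1$; every rational in $(0,1)$ is the mediant $\frac{r+r'}{s+s'}$ of exactly one pair of Farey neighbours in $[0,1]$. The $q$-Markov numbers $m^t_q\in\mathbb{Z}[q^{\pm1}]$, for $t\in(\mathbb{Q}\cap[0,1])\cup\{\frac10\}$, are defined recursively by $m^{0/1}_q=1$, $m^{1/1}_q=q+q^{ -1}$, $m^{1/0}_q=1$, and, for Farey neighbours $\frac rs<\frac{r'}{s'}$ in $[0,1]$, $$m_q^{\frac{r+r'}{s+s'}}=q^{ -1}[3]_q\,m_q^{r/s}\,m_q^{r'/s'}-m_q^{\frac{r'-r}{s'-s}},$$ where $\frac{r'-r}{s'-s}$ is understood as the rational number it represents (it is $\frac10$ when $s=s'$, i.e. for the pair $\frac01,\frac11$). (At $q=1$ these are the classical Markov numbers $m^t$ labelled by the Farey tree, and each triple $(m_q^{r/s},m_q^{r'/s'},m_q^{(r+r')/(s+s')})$ is the unique triple of Laurent polynomials satisfying $a_q^2+b_q^2+c_q^2=q^{ -1}[3]_qa_qb_qc_q+(q-1)(q^{ -1}-1)$ specializing to the corresponding Markov triple.) -}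

module Defs where

open import Data.Nat as ℕ using (ℕ; zero; suc; _⊔_; _≡ᵇ_; _<ᵇ_)
open import Data.Integer as ℤ using (ℤ; +_; -[1+_])
open import Data.List using (List; []; _∷_; replicate; _++_)
open import Data.Bool using (if_then_else_)
open import Data.Rational using (ℚ; ↥_; ↧ₙ_)

-- Laurent polynomials in q with integer coefficients.
-- lp e (c₀ ∷ c₁ ∷ … ∷ cₙ ∷ [])  represents  q^(-e) · (c₀ + c₁ q + … + cₙ qⁿ).
-- The representation is not unique; the meaning of an element is its
-- coefficient function `coeff`, and two Laurent polynomials are equal
-- iff their coefficient functions agree.

record LP : Set where
  constructor lp
  field
    shift : ℕ
    cs    : List ℤ

padd : List ℤ → List ℤ → List ℤ
padd []       ys       = ys
padd xs       []       = xs
padd (x ∷ xs) (y ∷ ys) = (x ℤ.+ y) ∷ padd xs ys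

pneg : List ℤ → List ℤ
pneg []       = []
pneg (x ∷ xs) = ℤ.- x ∷ pneg xs

pscale : ℤ → List ℤ → List ℤ
pscale a []       = []
pscale a (y ∷ ys) = (a ℤ.* y) ∷ pscale a ys

pmul : List ℤ → List ℤ → List ℤ
pmul []       ys = []
pmul (x ∷ xs) ys = padd (pscale x ys) (+ 0 ∷ pmul xs ys)

nth : List ℤ → ℕ → ℤ
nth []       _       = + 0
nth (x ∷ xs) zero    = x
nth (x ∷ xs) (suc n) = nth xs n

coeff : LP → ℤ → ℤ
coeff (lp e cs) k with k ℤ.+ + e
... | + n     = nth cs n
... | -[1+ _ ] = + 0

raise : ℕ → LP → LP
raise d (lp e cs) = lp (e ℕ.+ d) (replicate d (+ 0) ++ cs)

_-L_ : LP → LP → LP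
lp e cs -L lp f ds =
  let m = e ⊔ f in
  lp m (padd (LP.cs (raise (m ℕ.∸ e) (lp e cs)))
             (pneg (LP.cs (raise (m ℕ.∸ f) (lp f ds)))))

_*L_ : LP → LP → LP
lp e cs *L lp f ds = lp (e ℕ.+ f) (pmul cs ds)

oneL : LP
oneL = lp 0 (+ 1 ∷ [])

qPlusQinv : LP
qPlusQinv = lp 1 (+ 1 ∷ + 0 ∷ + 1 ∷ [])

q⁻¹[3] : LP
q⁻¹[3] = lp 1 (+ 1 ∷ + 1 ∷ + 1 ∷ [])

-- fareyGo fuel p q r s r' s' a b c :
--   (r/s, r'/s') are Farey neighbours, a = m_q^{r/s}, b = m_q^{r'/s'},
--   c = m_q^{(r'-r)/(s'-s)}, and the target p/q lies strictly between
--   r/s and r'/s'.  The mediant value is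
--   M = q⁻¹[3]_q · a · b − c.  If p/q is the mediant, return M; if it lies
--   to the left, continue with neighbours (r/s, mediant), whose "third"
--   rational is r'/s'; otherwise continue with (mediant, r'/s'), whose
--   "third" rational is r/s.  The fuel q suffices (depth of p/q in the
--   Farey tree is < q); the fuel-0 case is never reached for valid input.

fareyGo : ℕ → (p q r s r' s' : ℕ) → LP → LP → LP → LP
fareyGo zero    p q r s r' s' a b c = oneL
fareyGo (suc n) p q r s r' s' a b c =
  let M = (q⁻¹[3] *L (a *L b)) -L c
      R = r ℕ.+ r'
      S = s ℕ.+ s'
  in if (p ℕ.* S) ≡ᵇ (q ℕ.* R) then M
     else if (p ℕ.* S) <ᵇ (q ℕ.* R)
          then fareyGo n p q r s R S a M b
          else fareyGo n p q R S r' s' M b a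

-- m_q^{p/q} for a fraction p/q in lowest terms with 0 ≤ p ≤ q, q > 0.
mqFrac : ℕ → ℕ → LP
mqFrac p q =
  if p ≡ᵇ 0 then oneL
  else if p ≡ᵇ q then qPlusQinv
  else fareyGo q p q 0 1 1 1 oneL qPlusQinv oneL
  -- start: neighbours 0/1, 1/1 with third rational 1/0 (m = 1)

-- m_q^t for a rational t ∈ [0,1] (Data.Rational stores t in lowest terms).
mq : ℚ → LP
mq t = mqFrac ℤ.∣ ↥ t ∣ (↧ₙ t)

{-# OPTIONS --safe #-}
-- Write t = r/s in lowest terms and σ = s - 1. Along the Farey tree,
-- m_q^{r/s} = q^-(r+σ) (1 + σ q + higher powers of q): this holds at 0/1 and 1/1; the lowest
-- terms of q⁻¹[3]_q m_q^{r/s} m_q^{r'/s'} are the product of those of its factors, and the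
-- subtracted m_q^{(r'-r)/(s'-s)} starts at least two degrees higher.  So m_q^t determines
-- r + σ and σ, hence t.
module Submission where

open import Defs
open import Data.Rational using (ℚ; 0ℚ; 1ℚ; _≤_)
open import Data.Integer using (ℤ)
open import Relation.Binary.PropositionalEquality using (_≡_; _≢_)
open import Relation.Nullary using (¬_)

open import Data.Bool using (true; false)
open import Data.Empty using (⊥-elim)
open import Data.Integer as ℤ using (+_; -[1+_])
import Data.Integer.Properties as ℤP
import Data.Integer.Tactic.RingSolver as ℤ-Solver
open import Data.List using ([]; _∷_; replicate; _++_)
open import Data.Nat as ℕ using (ℕ; zero; suc; _+_; _*_; _<_; _≡ᵇ_; _<ᵇ_; s≤s; z≤n)
import Data.Nat.Properties as ℕP
open import Data.Nat.Coprimality using (Coprime)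
open import Data.Nat.Tactic.RingSolver using (solve; solve-∀)
open import Data.Product using (_×_; _,_; ∃₂)
open import Data.Rational as ℚ using (mkℚ; *≤*; _/_)
import Data.Rational.Properties as ℚP
import Data.Rational.Unnormalised as ℚᵘ
open import Data.Unit using (tt)
open import Function using (_∘_)
open import Relation.Binary.PropositionalEquality
  using (refl; sym; trans; cong; cong₂; subst₂; _≗_; module ≡-Reasoning)

private variable
  p q r r' s s' σ σ' e f : ℕ
  α β : ℤ
  a b c x y : LP

nth-padd : ∀ xs ys n → nth (padd xs ys) n ≡ nth xs n ℤ.+ nth ys n
nth-padd []       ys       n       = sym (ℤP.+-identityˡ _)
nth-padd (x ∷ xs) []       n       = sym (ℤP.+-identityʳ _)
nth-padd (x ∷ xs) (y ∷ ys) zero    = refl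
nth-padd (x ∷ xs) (y ∷ ys) (suc n) = nth-padd xs ys n

nth-pneg : ∀ xs n → nth (pneg xs) n ≡ ℤ.- nth xs n
nth-pneg []       n       = refl
nth-pneg (x ∷ xs) zero    = refl
nth-pneg (x ∷ xs) (suc n) = nth-pneg xs n

nth-pscale : ∀ a ys n → nth (pscale a ys) n ≡ a ℤ.* nth ys n
nth-pscale a []       n       = sym (ℤP.*-zeroʳ a)
nth-pscale a (y ∷ ys) zero    = refl
nth-pscale a (y ∷ ys) (suc n) = nth-pscale a ys n

nth-pmul-0 : ∀ xs ys → nth (pmul xs ys) 0 ≡ nth xs 0 ℤ.* nth ys 0
nth-pmul-0 []       ys = refl
nth-pmul-0 (x ∷ xs) ys =
  trans (nth-padd (pscale x ys) _ 0) (trans (ℤP.+-identityʳ _) (nth-pscale x ys 0))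

nth-pmul-1 : ∀ xs ys →
             nth (pmul xs ys) 1 ≡ nth xs 0 ℤ.* nth ys 1 ℤ.+ nth xs 1 ℤ.* nth ys 0
nth-pmul-1 []       ys = refl
nth-pmul-1 (x ∷ xs) ys =
  trans (nth-padd (pscale x ys) _ 1) (cong₂ ℤ._+_ (nth-pscale x ys 1) (nth-pmul-0 xs ys))

nth-replicate-++ : ∀ {i k} xs → i < k → nth (replicate k (+ 0) ++ xs) i ≡ + 0
nth-replicate-++ {zero}  {suc k} xs _         = refl
nth-replicate-++ {suc i} {suc k} xs (s≤s i<k) = nth-replicate-++ xs i<k

coeff-lp : ∀ {e n} cs k → k ℤ.+ + e ≡ + n → coeff (lp e cs) k ≡ nth cs n
coeff-lp {e} cs k eq with k ℤ.+ + e | eq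
... | _ | refl = refl

coeff-lp-negative : ∀ {e} cs k → k ℤ.+ + e ℤ.< + 0 → coeff (lp e cs) k ≡ + 0
coeff-lp-negative {e} cs k neg with k ℤ.+ + e | neg
... | -[1+ _ ] | _         = refl
... | + _      | ℤ.+<+ ()

record LowestTerms (x : LP) (e : ℕ) (α : ℤ) : Set where
  constructor lowestTerms
  field
    shift≡ : LP.shift x ≡ e
    nth₀   : nth (LP.cs x) 0 ≡ + 1
    nth₁   : nth (LP.cs x) 1 ≡ α

q⁻¹[3]-lowestTerms : LowestTerms q⁻¹[3] 1 (+ 1)
q⁻¹[3]-lowestTerms = lowestTerms refl refl refl

*L-lowestTerms : LowestTerms x e α → LowestTerms y f β → LowestTerms (x *L y) (e + f) (α ℤ.+ β)
*L-lowestTerms {x = lp e cs} {α = α} {y = lp f ds} {β = β}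
               (lowestTerms refl c₀ c₁) (lowestTerms refl d₀ d₁) =
  lowestTerms refl constant linear
  where
  open ≡-Reasoning
  constant : nth (pmul cs ds) 0 ≡ + 1
  constant = trans (nth-pmul-0 cs ds) (cong₂ ℤ._*_ c₀ d₀)
  linear : nth (pmul cs ds) 1 ≡ α ℤ.+ β
  linear = begin
    nth (pmul cs ds) 1                                ≡⟨ nth-pmul-1 cs ds ⟩
    nth cs 0 ℤ.* nth ds 1 ℤ.+ nth cs 1 ℤ.* nth ds 0
      ≡⟨ cong₂ ℤ._+_ (cong₂ ℤ._*_ c₀ d₁) (cong₂ ℤ._*_ c₁ d₀) ⟩
    + 1 ℤ.* β ℤ.+ α ℤ.* + 1
      ≡⟨ cong₂ ℤ._+_ (ℤP.*-identityˡ β) (ℤP.*-identityʳ α) ⟩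
    β ℤ.+ α                                           ≡⟨ ℤP.+-comm β α ⟩
    α ℤ.+ β                                           ∎

-L-lowestTerms : LowestTerms x e α → 2 + LP.shift y ℕ.≤ e → LowestTerms (x -L y) e α
-L-lowestTerms {x = lp e cs} {y = lp f ds} (lowestTerms refl c₀ c₁) f+2≤e
  rewrite ℕP.m≥n⇒m⊔n≡m (ℕP.m+n≤o⇒n≤o 2 f+2≤e) | ℕP.n∸n≡0 e =
  lowestTerms refl (trans (unchanged 0 (ℕP.<-≤-trans (s≤s z≤n) 2≤e∸f)) c₀)
                   (trans (unchanged 1 2≤e∸f) c₁)
  where
  open ≡-Reasoning
  2≤e∸f : 2 ℕ.≤ e ℕ.∸ f
  2≤e∸f = ℕP.m+n≤o⇒m≤o∸n 2 f+2≤e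
  unchanged : ∀ i → i < e ℕ.∸ f →
              nth (padd cs (pneg (replicate (e ℕ.∸ f) (+ 0) ++ ds))) i ≡ nth cs i
  unchanged i i<e∸f = begin
    nth (padd cs (pneg (replicate (e ℕ.∸ f) (+ 0) ++ ds))) i
      ≡⟨ nth-padd cs (pneg (replicate (e ℕ.∸ f) (+ 0) ++ ds)) i ⟩
    nth cs i ℤ.+ nth (pneg (replicate (e ℕ.∸ f) (+ 0) ++ ds)) i
      ≡⟨ cong (ℤ._+_ (nth cs i)) (nth-pneg (replicate (e ℕ.∸ f) (+ 0) ++ ds) i) ⟩
    nth cs i ℤ.+ ℤ.- nth (replicate (e ℕ.∸ f) (+ 0) ++ ds) i
      ≡⟨ cong (λ z → nth cs i ℤ.+ ℤ.- z) (nth-replicate-++ ds i<e∸f) ⟩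
    nth cs i ℤ.+ + 0
      ≡⟨ ℤP.+-identityʳ _ ⟩
    nth cs i ∎

lowestTerms-coeff₀ : LowestTerms x e α → coeff x (ℤ.- + e) ≡ + 1
lowestTerms-coeff₀ {x = lp e cs} (lowestTerms refl c₀ _) =
  trans (coeff-lp cs (ℤ.- + e) (ℤP.+-inverseˡ (+ e))) c₀

lowestTerms-coeff₁ : LowestTerms x e α → coeff x (ℤ.- + e ℤ.+ + 1) ≡ α
lowestTerms-coeff₁ {x = lp e cs} (lowestTerms refl _ c₁) =
  trans (coeff-lp cs (ℤ.- + e ℤ.+ + 1) (cancel (+ e) (+ 1))) c₁
  where
  cancel : ∀ i j → (ℤ.- i ℤ.+ j) ℤ.+ i ≡ j
  cancel = ℤ-Solver.solve-∀

lowestTerms-coeff-below : LowestTerms x f α → f < e → coeff x (ℤ.- + e) ≡ + 0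
lowestTerms-coeff-below {x = lp f cs} {e = e} (lowestTerms refl _ _) f<e =
  coeff-lp-negative cs (ℤ.- + e)
    (subst₂ ℤ._<_ refl (ℤP.+-inverseˡ (+ e)) (ℤP.+-monoʳ-< (ℤ.- + e) (ℤ.+<+ f<e)))

lowestTerms-shift-≤ : LowestTerms x e α → LowestTerms y f β → coeff x ≗ coeff y → e ℕ.≤ f
lowestTerms-shift-≤ {e = e} x≈ y≈ x≗y = ℕP.≮⇒≥ λ f<e →
  1≢0 (trans (sym (lowestTerms-coeff₀ x≈)) (trans (x≗y (ℤ.- + e)) (lowestTerms-coeff-below y≈ f<e)))
  where
  1≢0 : + 1 ≢ + 0
  1≢0 ()

lowestTerms-unique : LowestTerms x e α → LowestTerms y f β → coeff x ≗ coeff y → e ≡ f × α ≡ β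
lowestTerms-unique {e = e} x≈ y≈ x≗y
  with refl ← ℕP.≤-antisym (lowestTerms-shift-≤ x≈ y≈ x≗y) (lowestTerms-shift-≤ y≈ x≈ (sym ∘ x≗y))
  = refl , trans (sym (lowestTerms-coeff₁ x≈)) (trans (x≗y (ℤ.- + e ℤ.+ + 1)) (lowestTerms-coeff₁ y≈))

-- the lowest terms q^-(r+s-1) (1 + (s-1) q) of m_q^{r/s}, written with σ = s - 1
MarkovShape : ℕ → ℕ → LP → Set
MarkovShape r σ x = LowestTerms x (r + σ) (+ σ)

markovShape-unique : MarkovShape r σ x → MarkovShape r' σ' y → coeff x ≗ coeff y →
                     r ≡ r' × σ ≡ σ'
markovShape-unique {r = r} {σ = σ} {r' = r'} {σ' = σ'} x≈ y≈ x≗y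
  with r+σ≡r'+σ' , σ≡σ' ← lowestTerms-unique x≈ y≈ x≗y
  with refl ← ℤP.+-injective σ≡σ'
  = ℕP.+-cancelʳ-≡ σ r r' r+σ≡r'+σ' , refl

markovMediant : LP → LP → LP → LP
markovMediant a b c = (q⁻¹[3] *L (a *L b)) -L c

markovMediant-lowestTerms : LowestTerms a e α → LowestTerms b f β → LP.shift c < e + f →
                            LowestTerms (markovMediant a b c) (suc (e + f)) (+ 1 ℤ.+ (α ℤ.+ β))
markovMediant-lowestTerms a≈ b≈ c< =
  -L-lowestTerms (*L-lowestTerms q⁻¹[3]-lowestTerms (*L-lowestTerms a≈ b≈)) (s≤s c<)

mediant-exponent : ∀ r σ r' σ' → (r + r') + (σ + suc σ') ≡ suc ((r + σ) + (r' + σ'))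
mediant-exponent = solve-∀

markovMediant-shape : MarkovShape r σ a → MarkovShape r' σ' b → LP.shift c < (r + σ) + (r' + σ') →
                      MarkovShape (r + r') (σ + suc σ') (markovMediant a b c)
markovMediant-shape {r = r} {σ = σ} {r' = r'} {σ' = σ'} a≈ b≈ c< =
  subst₂ (LowestTerms _) (sym (mediant-exponent r σ r' σ')) (cong +_ (linear-coefficient σ σ'))
         (markovMediant-lowestTerms a≈ b≈ c<)
  where
  linear-coefficient : ∀ σ σ' → 1 + (σ + σ') ≡ σ + suc σ'
  linear-coefficient = solve-∀

record BetweenNeighbours (p q r s r' s' : ℕ) : Set where
  constructor betweenNeighbours
  field
    neighbours : r' * s ≡ r * s' + 1
    lower      : q * r < p * s
    upper      : p * s' < q * r'

-- q = q (r' s - r s') = s (q r') - s' (q r) ≥ s (p s' + 1) - s' (p s - 1) = s + s'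
betweenNeighbours-denominators : BetweenNeighbours p q r s r' s' → s + s' ℕ.≤ q
betweenNeighbours-denominators {p = p} {q = q} {r = r} {s = s} {r' = r'} {s' = s'}
                               (betweenNeighbours neighbours lower upper) =
  ℕP.+-cancelˡ-≤ (q * r * s') (s + s') q (begin
    q * r * s' + (s + s')  ≡⟨ solve (q ∷ r ∷ s ∷ s' ∷ []) ⟩
    suc (q * r) * s' + s   ≤⟨ ℕP.+-monoˡ-≤ s (ℕP.*-monoˡ-≤ s' lower) ⟩
    p * s * s' + s         ≡⟨ solve (p ∷ s ∷ s' ∷ []) ⟩
    suc (p * s') * s       ≤⟨ ℕP.*-monoˡ-≤ s upper ⟩
    q * r' * s             ≡⟨ ℕP.*-assoc q r' s ⟩
    q * (r' * s)           ≡⟨ cong (q *_) neighbours ⟩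
    q * (r * s' + 1)       ≡⟨ solve (q ∷ r ∷ s' ∷ []) ⟩
    q * r * s' + q         ∎)
  where open ℕP.≤-Reasoning

betweenNeighbours-left : BetweenNeighbours p q r s r' s' → p * (s + s') < q * (r + r') →
                         BetweenNeighbours p q r s (r + r') (s + s')
betweenNeighbours-left {r = r} {s = s} {r' = r'} {s' = s'} (betweenNeighbours neighbours lower _) upper =
  betweenNeighbours (begin
    (r + r') * s         ≡⟨ ℕP.*-distribʳ-+ s r r' ⟩
    r * s + r' * s       ≡⟨ cong (_+_ (r * s)) neighbours ⟩
    r * s + (r * s' + 1) ≡⟨ solve (r ∷ s ∷ s' ∷ []) ⟩
    r * (s + s') + 1     ∎) lower upper
  where open ≡-Reasoning

betweenNeighbours-right : BetweenNeighbours p q r s r' s' → q * (r + r') < p * (s + s') →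
                          BetweenNeighbours p q (r + r') (s + s') r' s'
betweenNeighbours-right {r = r} {s = s} {r' = r'} {s' = s'} (betweenNeighbours neighbours _ upper) lower =
  betweenNeighbours (begin
    r' * (s + s')          ≡⟨ ℕP.*-distribˡ-+ r' s s' ⟩
    r' * s + r' * s'       ≡⟨ cong (λ z → z + r' * s') neighbours ⟩
    r * s' + 1 + r' * s'   ≡⟨ solve (r ∷ r' ∷ s' ∷ []) ⟩
    (r + r') * s' + 1      ∎) lower upper
  where open ≡-Reasoning

record MarkovTriple (r σ r' σ' : ℕ) (a b c : LP) : Set where
  constructor markovTriple
  field
    shapeˡ       : MarkovShape r σ a
    shapeʳ       : MarkovShape r' σ' b
    third-shift< : LP.shift c < (r + σ) + (r' + σ')

markovTriple-left : MarkovTriple r σ r' σ' a b c →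
                    MarkovTriple r σ (r + r') (σ + suc σ') a (markovMediant a b c) b
markovTriple-left {r = r} {σ = σ} {r' = r'} {σ' = σ'} {b = b} (markovTriple a≈ b≈ c<) =
  markovTriple a≈ (markovMediant-shape a≈ b≈ c<) (begin-strict
    LP.shift b                          ≡⟨ LowestTerms.shift≡ b≈ ⟩
    r' + σ'                             <⟨ s≤s (ℕP.m≤n+m (r' + σ') (r + σ)) ⟩
    suc ((r + σ) + (r' + σ'))           ≡⟨ mediant-exponent r σ r' σ' ⟨
    (r + r') + (σ + suc σ')             ≤⟨ ℕP.m≤n+m _ (r + σ) ⟩
    (r + σ) + ((r + r') + (σ + suc σ')) ∎)
  where open ℕP.≤-Reasoning

markovTriple-right : MarkovTriple r σ r' σ' a b c →
                     MarkovTriple (r + r') (σ + suc σ') r' σ' (markovMediant a b c) b a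
markovTriple-right {r = r} {σ = σ} {r' = r'} {σ' = σ'} {a = a} (markovTriple a≈ b≈ c<) =
  markovTriple (markovMediant-shape a≈ b≈ c<) b≈ (begin-strict
    LP.shift a                            ≡⟨ LowestTerms.shift≡ a≈ ⟩
    r + σ                                 <⟨ s≤s (ℕP.m≤m+n (r + σ) (r' + σ')) ⟩
    suc ((r + σ) + (r' + σ'))             ≡⟨ mediant-exponent r σ r' σ' ⟨
    (r + r') + (σ + suc σ')               ≤⟨ ℕP.m≤m+n _ (r' + σ') ⟩
    ((r + r') + (σ + suc σ')) + (r' + σ') ∎)
  where open ℕP.≤-Reasoning

MarkovShapeAt : ℕ → ℕ → LP → Set
MarkovShapeAt p q x = ∃₂ λ r σ → p * suc σ ≡ q * r × MarkovShape r σ x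

-- The fuel never runs out: s + s' ≤ q, and s + s' grows at every step.
fareyGo-shape : ∀ n → BetweenNeighbours p q r (suc σ) r' (suc σ') → MarkovTriple r σ r' σ' a b c →
                q < n + (suc σ + suc σ') →
                MarkovShapeAt p q (fareyGo n p q r (suc σ) r' (suc σ') a b c)
fareyGo-shape zero between _ fuel = ⊥-elim (ℕP.<⇒≱ fuel (betweenNeighbours-denominators between))
fareyGo-shape {p = p} {q = q} {r = r} {σ = σ} {r' = r'} {σ' = σ'} (suc n) between triple fuel
  -- abstracting the test inside ≡ᵇ⇒≡ and ≡⇒≡ᵇ as well turns them into evidence for its outcome
  with p * (suc σ + suc σ') ≡ᵇ q * (r + r')
     | ℕP.≡ᵇ⇒≡ (p * (suc σ + suc σ')) (q * (r + r'))
     | ℕP.≡⇒≡ᵇ (p * (suc σ + suc σ')) (q * (r + r'))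
... | true  | hit | _ = r + r' , σ + suc σ' , hit tt , markovMediant-shape shapeˡ shapeʳ third-shift<
  where open MarkovTriple triple
... | false | _ | miss
  with p * (suc σ + suc σ') <ᵇ q * (r + r')
     | ℕP.<ᵇ⇒< (p * (suc σ + suc σ')) (q * (r + r'))
     | ℕP.<⇒<ᵇ {p * (suc σ + suc σ')} {q * (r + r')}
... | true  | left | _ =
  fareyGo-shape n (betweenNeighbours-left between (left tt)) (markovTriple-left triple)
    (ℕP.<-≤-trans fuel (ℕP.+-monoʳ-< n (ℕP.m<n+m _ (s≤s z≤n))))
... | false | _ | not-left =
  fareyGo-shape n (betweenNeighbours-right between (ℕP.≤∧≢⇒< (ℕP.≮⇒≥ not-left) (miss ∘ sym)))
    (markovTriple-right triple)
    (ℕP.<-≤-trans fuel (ℕP.+-monoʳ-< n (ℕP.m<m+n _ (s≤s z≤n))))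

mqFrac-shape : ∀ p d → p ℕ.≤ suc d → MarkovShapeAt p (suc d) (mqFrac p (suc d))
mqFrac-shape p d p≤q with p ≡ᵇ 0 | ℕP.≡ᵇ⇒≡ p 0 | ℕP.≡⇒≡ᵇ p 0
... | true  | p≡0 | _ =
  0 , 0 , trans (cong (_* 1) (p≡0 tt)) (sym (ℕP.*-zeroʳ (suc d))) , lowestTerms refl refl refl
... | false | _ | p≢0 with p ≡ᵇ suc d | ℕP.≡ᵇ⇒≡ p (suc d) | ℕP.≡⇒≡ᵇ p (suc d)
...   | true  | p≡q | _ = 1 , 0 , cong (_* 1) (p≡q tt) , lowestTerms refl refl refl
...   | false | _ | p≢q =
  fareyGo-shape {p = p} {r = 0} {σ = 0} {r' = 1} {σ' = 0} {a = oneL} {b = qPlusQinv} {c = oneL}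
    (suc d) (betweenNeighbours refl lower upper)
    (markovTriple (lowestTerms refl refl refl) (lowestTerms refl refl refl) (s≤s z≤n))
    (ℕP.m<m+n (suc d) (s≤s z≤n))
  where
  lower : suc d * 0 < p * 1
  lower rewrite ℕP.*-zeroʳ d | ℕP.*-identityʳ p = ℕP.n≢0⇒n>0 p≢0
  upper : p * 1 < suc d * 1
  upper rewrite ℕP.*-identityʳ p | ℕP.*-identityʳ d = ℕP.≤∧≢⇒< p≤q p≢q

≤1ℚ⇒numerator≤denominator : ∀ {p d} .{c : Coprime p (suc d)} → mkℚ (+ p) d c ≤ 1ℚ → p ℕ.≤ suc d
≤1ℚ⇒numerator≤denominator {p} {d} (*≤* t≤1) =
  ℤP.drop‿+≤+ (subst₂ ℤ._≤_ (ℤP.*-identityʳ (+ p)) (ℤP.*-identityˡ (+ suc d)) t≤1)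

mkℚ≡/ : ∀ {p d r σ} .{c : Coprime p (suc d)} → p * suc σ ≡ suc d * r → mkℚ (+ p) d c ≡ + r / suc σ
mkℚ≡/ {p} {d} {r} {σ} {c} ps≡qr =
  trans (sym (ℚP.fromℚᵘ-toℚᵘ (mkℚ (+ p) d c)))
        (ℚP.fromℚᵘ-cong {ℚᵘ.mkℚᵘ (+ p) d} {ℚᵘ.mkℚᵘ (+ r) σ} (ℚᵘ.*≡* cross))
  where
  open ≡-Reasoning
  cross : + p ℤ.* + suc σ ≡ + r ℤ.* + suc d
  cross = begin
    + p ℤ.* + suc σ  ≡⟨ ℤP.pos-* p (suc σ) ⟨
    + (p * suc σ)    ≡⟨ cong +_ (trans ps≡qr (ℕP.*-comm (suc d) r)) ⟩
    + (r * suc d)    ≡⟨ ℤP.pos-* r (suc d) ⟩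
    + r ℤ.* + suc d  ∎

mq-shape : ∀ t → 0ℚ ≤ t → t ≤ 1ℚ → ∃₂ λ r σ → t ≡ + r / suc σ × MarkovShape r σ (mq t)
mq-shape (mkℚ -[1+ _ ] _ _) (*≤* ()) _
mq-shape (mkℚ (+ p) d _) _ t≤1
  with r , σ , ps≡qr , shape ← mqFrac-shape p d (≤1ℚ⇒numerator≤denominator t≤1)
  = r , σ , mkℚ≡/ ps≡qr , shape

corollary1p4 : (t t' : ℚ) → 0ℚ ≤ t → t ≤ 1ℚ → 0ℚ ≤ t' → t' ≤ 1ℚ → t ≢ t'
    → ¬ (∀ (k : ℤ) → coeff (mq t) k ≡ coeff (mq t') k)
corollary1p4 t t' 0≤t t≤1 0≤t' t'≤1 t≢t' mqt≗mqt'
  with r , σ , t≡r/s , shape ← mq-shape t 0≤t t≤1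
     | r' , σ' , t'≡r'/s' , shape' ← mq-shape t' 0≤t' t'≤1
  with refl , refl ← markovShape-unique {r = r} {r' = r'} shape shape' mqt≗mqt'
  = t≢t' (trans t≡r/s (sym t'≡r'/s'))
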